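{- Let $d \geq 3$, $t \geq 1$ and $n \geq 2t$ be integers. Then the undirected de Bruijn graph $\mathcal{B}(d,n)$ is $t$-identifiable, i.e. it admits a $t$-identifying code.
   Context: Let $[d]=\{0,1,\ldots,d-1\}$. The directed de Bruijn graph $\vec{\mathcal{B}}(d,n)$ has vertex set the set of all strings of length $n$ over $[d]$, and for each string $x_1x_2\ldots x_{n+1}$ of length $n+1$ over $[d]$ an edge from $x_1\ldots x_n$ to $x_2\ldots x_{n+1}$. The undirected de Bruijn graph $\mathcal{B}(d,n)$ is $\vec{\mathcal{B}}(d,n)$ with edge directions ignored. For a vertex $x$, $B_t(x)$ denotes the set of vertices $y$ with graph distance $d(x,y)\le t$. A subset $S\subseteq V(G)$ is a $t$-identifying code of a graph $G$ if (1) $B_t(x)\cap S\neq\emptyset$ for every vertex $x$, and (2) $B_t(x)\cap S\neq B_t(y)\cap S$ for all distinct vertices $x,y$. A graph is $t$-identifiable if it has a $t$-identifying code. -}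

module Defs where

open import Data.Nat using (ℕ; zero; suc; _≤_)
open import Data.Fin using (Fin)
open import Data.Vec using (Vec; _∷_; _∷ʳ_)
open import Data.Product using (∃₂; Σ; _×_; ∃)
open import Data.Bool using (Bool; true)
open import Relation.Binary.PropositionalEquality using (_≡_)
open import Relation.Nullary using (¬_)
open import Data.Sum using (_⊎_)
open import Function.Bundles using (_⇔_)

Word : ℕ → ℕ → Set
Word d n = Vec (Fin d) n

-- Directed edge x₁…xₙ → x₂…xₙ₊₁ of the directed de Bruijn graph, given by
-- the string x₁…xₙ₊₁ : appending xₙ₊₁ to x equals prepending x₁ to y.
Arc : ∀ {d n} → Word d n → Word d n → Set
Arc {d} x y = ∃₂ λ (a b : Fin d) → x ∷ʳ b ≡ a ∷ y

Adj : ∀ {d n} → Word d n → Word d n → Set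
Adj x y = Arc x y ⊎ Arc y x

data WalkOfLen {d n : ℕ} : ℕ → Word d n → Word d n → Set where
  here : ∀ {x} → WalkOfLen zero x x
  step : ∀ {k x y z} → Adj x y → WalkOfLen k y z → WalkOfLen (suc k) x z

InBall : ∀ {d n} → ℕ → Word d n → Word d n → Set
InBall t x y = Σ ℕ λ k → k ≤ t × WalkOfLen k x y

-- A vertex subset, given by its (decidable) characteristic function.
Subset : ℕ → ℕ → Set
Subset d n = Word d n → Bool

_∈S_ : ∀ {d n} → Word d n → Subset d n → Set
z ∈S S = S z ≡ true

IsIdentifyingCode : (d n t : ℕ) → Subset d n → Set
IsIdentifyingCode d n t S =
  (∀ (x : Word d n) → ∃ λ z → InBall t x z × z ∈S S)
  × (∀ (x y : Word d n) → ¬ x ≡ y →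
       ¬ (∀ (z : Word d n) → z ∈S S → (InBall t x z ⇔ InBall t y z)))

Identifiable : (d n t : ℕ) → Set
Identifiable d n t = ∃ λ (S : Subset d n) → IsIdentifyingCode d n t S

-- Take every vertex as the code, so it suffices that distinct words have distinct t-balls.
-- Along a walk of length k from y to z a common window y[u, u + L) = z[v, v + L) survives
-- with 2 (n − L) ≤ k + |u − v|.  If x and y differ at a position ≥ t, let z be x shifted
-- left t times, the j-th new letter chosen (as d ≥ 3) unequal to the letters of y at
-- positions n − 1 − j and n − 2 − j.  Then z is at distance t from x, while for k ≤ t a
-- window from y to z is either y[t, n) = z[0, n − t) = x[t, n), contradicting the
-- difference, or puts a new letter of z opposite one of the letters of y it avoids.
-- If x and y agree from position t on, they differ among the first t ≤ n − t letters,
-- and reversing both words, an automorphism of the graph, reduces to the first case.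
module Submission where

open import Defs
open import Data.Nat using (ℕ; _≤_; _*_)
open import Data.Nat.Base using (zero; suc; _+_; _∸_; _<_; z≤n; s≤s)
open import Data.Nat.Properties
  using ( _≤?_; _<?_; suc-injective; +-assoc; +-comm; +-identityʳ; +-suc
        ; +-cancelˡ-≡; +-cancelʳ-≡; +-cancelˡ-≤; +-cancelʳ-≤; +-cancelˡ-<; +-cancelʳ-<
        ; +-mono-≤; +-monoˡ-≤; +-monoʳ-≤; +-monoʳ-<; m≤m+n; m≤n+m; m<n+m; n≤1+n; n<1+n
        ; ≤-refl; ≤-reflexive; ≤-trans; ≤-antisym; <-trans; ≤⇒≯; ≮⇒≥; ≰⇒>
        ; m+n∸n≡m; m+n≡0⇒m≡0; n≤0⇒n≡0; m≤n⇒∃[o]m+o≡n; module ≤-Reasoning )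
open import Data.Nat.Tactic.RingSolver using (solve)
open import Data.Fin using (Fin)
open import Data.Fin.Patterns using (0F; 1F; 2F)
open import Data.Fin.Properties using () renaming (_≟_ to _≟ᶠ_)
open import Data.Maybe using (Maybe; just; nothing)
open import Data.Maybe.Properties using (≡-dec; just-injective)
open import Data.Vec using (Vec; []; _∷_; _∷ʳ_; tail; head; reverse)
open import Data.Vec.Properties using (reverse-∷; reverse-involutive)
open import Data.List using (List; []; _∷_)
open import Data.Product using (∃; ∃₂; _×_; _,_; proj₁; proj₂)
open import Data.Sum using (_⊎_; inj₁; inj₂; [_,_]′)
open import Data.Bool using (true)
open import Function using (_∋_)
open import Function.Bundles using (Equivalence; _⇔_)
open import Relation.Nullary using (¬_; Dec; yes; no; contradiction)
open import Relation.Binary.PropositionalEquality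

private
  variable
    A : Set
    d n k t : ℕ

at : Vec A n → ℕ → Maybe A
at []      _       = nothing
at (a ∷ _) zero    = just a
at (_ ∷ v) (suc i) = at v i

at-∷ʳ : ∀ (v : Vec A n) b {i} → i < n → at (v ∷ʳ b) i ≡ at v i
at-∷ʳ (_ ∷ _) b {zero}  _         = refl
at-∷ʳ (_ ∷ v) b {suc i} (s≤s i<n) = at-∷ʳ v b i<n

at-∷ʳ-length : ∀ (v : Vec A n) b → at (v ∷ʳ b) n ≡ just b
at-∷ʳ-length []      b = refl
at-∷ʳ-length (_ ∷ v) b = at-∷ʳ-length v b

at-tail : ∀ (v : Vec A (suc n)) i → at (tail v) i ≡ at v (suc i)
at-tail (_ ∷ _) i = refl

reverse-∷ʳ : ∀ (v : Vec A n) b → reverse (v ∷ʳ b) ≡ b ∷ reverse v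
reverse-∷ʳ v b = begin
  reverse (v ∷ʳ b)                   ≡⟨ cong (λ w → reverse (w ∷ʳ b)) (reverse-involutive v) ⟨
  reverse (reverse (reverse v) ∷ʳ b) ≡⟨ cong reverse (reverse-∷ b (reverse v)) ⟨
  reverse (reverse (b ∷ reverse v))  ≡⟨ reverse-involutive (b ∷ reverse v) ⟩
  b ∷ reverse v                      ∎
  where open ≡-Reasoning

at-reverse : ∀ (v : Vec A n) {i j} → suc (i + j) ≡ n → at (reverse v) i ≡ at v j
at-reverse {n = suc n} (a ∷ v) {i} {zero} eq = begin
  at (reverse (a ∷ v)) i  ≡⟨ cong (λ w → at w i) (reverse-∷ a v) ⟩
  at (reverse v ∷ʳ a) i   ≡⟨ cong (at (reverse v ∷ʳ a)) i≡n ⟩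
  at (reverse v ∷ʳ a) n   ≡⟨ at-∷ʳ-length (reverse v) a ⟩
  just a                  ∎
  where
  open ≡-Reasoning
  i≡n : i ≡ n
  i≡n = trans (sym (+-identityʳ i)) (suc-injective eq)
at-reverse {n = suc n} (a ∷ v) {i} {suc j} eq = begin
  at (reverse (a ∷ v)) i  ≡⟨ cong (λ w → at w i) (reverse-∷ a v) ⟩
  at (reverse v ∷ʳ a) i   ≡⟨ at-∷ʳ (reverse v) a (≤-trans (s≤s (m≤m+n i j)) (≤-reflexive i+1+j≡n)) ⟩
  at (reverse v) i        ≡⟨ at-reverse v i+1+j≡n ⟩
  at v j                  ∎
  where
  open ≡-Reasoning
  i+1+j≡n : suc (i + j) ≡ n
  i+1+j≡n = trans (sym (+-suc i j)) (suc-injective eq)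

arc-at : {x y : Word d n} → Arc x y → ∀ {i} → suc i < n → at y i ≡ at x (suc i)
arc-at {x = x} {y} (a , b , eq) {i} i+1<n = begin
  at y i              ≡⟨ cong (λ w → at w (suc i)) eq ⟨
  at (x ∷ʳ b) (suc i) ≡⟨ at-∷ʳ x b i+1<n ⟩
  at x (suc i)        ∎
  where open ≡-Reasoning

shift : Word d n → Fin d → Word d n
shift x b = tail (x ∷ʳ b)

arc-shift : ∀ (x : Word d n) b → Arc x (shift x b)
arc-shift x b = head (x ∷ʳ b) , b , head-∷-tail (x ∷ʳ b)
  where
  head-∷-tail : (v : Vec A (suc n)) → v ≡ head v ∷ tail v
  head-∷-tail (_ ∷ _) = refl

shifts : ℕ → (ℕ → Fin d) → Word d n → Word d n
shifts zero    f x = x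
shifts (suc k) f x = shifts k (λ j → f (suc j)) (shift x (f 0))

walk-shifts : ∀ k f (x : Word d n) → WalkOfLen k x (shifts k f x)
walk-shifts zero    f x = here
walk-shifts (suc k) f x = step (inj₁ (arc-shift x (f 0))) (walk-shifts k _ _)

at-shifts-kept : ∀ k f (x : Word d n) {i} → k + i < n → at (shifts k f x) i ≡ at x (k + i)
at-shifts-kept zero    f x k+i<n = refl
at-shifts-kept (suc k) f x {i} k+i<n = begin
  at (shifts k _ (shift x (f 0))) i ≡⟨ at-shifts-kept k _ (shift x (f 0)) (<-trans (n<1+n _) k+i<n) ⟩
  at (shift x (f 0)) (k + i)        ≡⟨ at-tail (x ∷ʳ f 0) (k + i) ⟩
  at (x ∷ʳ f 0) (suc k + i)         ≡⟨ at-∷ʳ x (f 0) k+i<n ⟩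
  at x (suc k + i)                  ∎
  where open ≡-Reasoning

at-shifts-new : ∀ k f (x : Word d n) {i j} → i + k ≡ n + j → j < k → at (shifts k f x) i ≡ just (f j)
at-shifts-new {n = n} (suc k) f x {i} {zero} eq _ = begin
  at (shifts k _ (shift x (f 0))) i ≡⟨ at-shifts-kept k _ (shift x (f 0)) (≤-reflexive k+i+1≡n) ⟩
  at (shift x (f 0)) (k + i)        ≡⟨ at-tail (x ∷ʳ f 0) (k + i) ⟩
  at (x ∷ʳ f 0) (suc k + i)         ≡⟨ cong (at (x ∷ʳ f 0)) k+i+1≡n ⟩
  at (x ∷ʳ f 0) n                   ≡⟨ at-∷ʳ-length x (f 0) ⟩
  just (f 0)                        ∎
  where
  open ≡-Reasoning
  k+i+1≡n : suc (k + i) ≡ n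
  k+i+1≡n = trans (cong suc (+-comm k i)) (trans (sym (+-suc i k)) (trans eq (+-identityʳ n)))
at-shifts-new {n = n} (suc k) f x {i} {suc j} eq (s≤s j<k) =
  at-shifts-new k _ (shift x (f 0)) (suc-injective (trans (sym (+-suc i k)) (trans eq (+-suc n j)))) j<k

arc-reverse : {x y : Word d n} → Arc x y → Arc (reverse y) (reverse x)
arc-reverse {x = x} {y} (a , b , eq) = b , a , (begin
  reverse y ∷ʳ a    ≡⟨ reverse-∷ a y ⟨
  reverse (a ∷ y)   ≡⟨ cong reverse eq ⟨
  reverse (x ∷ʳ b)  ≡⟨ reverse-∷ʳ x b ⟩
  b ∷ reverse x     ∎)
  where open ≡-Reasoning

adj-reverse : {x y : Word d n} → Adj x y → Adj (reverse x) (reverse y)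
adj-reverse (inj₁ xy) = inj₂ (arc-reverse xy)
adj-reverse (inj₂ yx) = inj₁ (arc-reverse yx)

walk-reverse : {x y : Word d n} → WalkOfLen k x y → WalkOfLen k (reverse x) (reverse y)
walk-reverse here       = here
walk-reverse (step a w) = step (adj-reverse a) (walk-reverse w)

inBall-reverse : {x y : Word d n} → InBall t x y → InBall t (reverse x) (reverse y)
inBall-reverse (k , k≤t , w) = k , k≤t , walk-reverse w

-- Cost n u v L k  states  2 (n − L) ≤ k + |u − v|  without subtraction.
data Cost (n u v L k : ℕ) : Set where
  costᵘ : n + n + v ≤ L + L + k + u → Cost n u v L k
  costᵛ : n + n + u ≤ L + L + k + v → Cost n u v L k

module _ {n u v L k : ℕ} where
  open ≤-Reasoning

  cost-mono : ∀ {k′} → k ≤ k′ → Cost n u v L k → Cost n u v L k′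
  cost-mono k≤k′ (costᵘ c) = costᵘ (≤-trans c (+-monoˡ-≤ u (+-monoʳ-≤ (L + L) k≤k′)))
  cost-mono k≤k′ (costᵛ c) = costᵛ (≤-trans c (+-monoˡ-≤ v (+-monoʳ-≤ (L + L) k≤k′)))

  cost-advance : Cost n u v L k → Cost n (suc u) v L (suc k)
  cost-advance (costᵘ c) = costᵘ (≤-trans c (+-mono-≤ (+-monoʳ-≤ (L + L) (n≤1+n k)) (n≤1+n u)))
  cost-advance (costᵛ c) = costᵛ (begin
    n + n + suc u     ≡⟨ +-suc (n + n) u ⟩
    suc (n + n + u)   ≤⟨ s≤s c ⟩
    suc (L + L + k + v) ≡⟨ solve (List ℕ ∋ L ∷ k ∷ v ∷ []) ⟩
    L + L + suc k + v ∎)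

  cost-advance-shrink : v ≤ u → Cost n u v (suc L) k → Cost n (suc u) v L (suc k)
  cost-advance-shrink v≤u c = costᵘ (begin
    n + n + v               ≤⟨ weaken c ⟩
    suc L + suc L + k + u   ≡⟨ solve (List ℕ ∋ L ∷ k ∷ u ∷ []) ⟩
    L + L + suc k + suc u   ∎)
    where
    weaken : Cost n u v (suc L) k → n + n + v ≤ suc L + suc L + k + u
    weaken (costᵘ c) = c
    weaken (costᵛ c) = begin
      n + n + v             ≤⟨ +-monoʳ-≤ (n + n) v≤u ⟩
      n + n + u             ≤⟨ c ⟩
      suc L + suc L + k + v ≤⟨ +-monoʳ-≤ (suc L + suc L + k) v≤u ⟩
      suc L + suc L + k + u ∎

  cost-retreat : Cost n (suc u) v L k → Cost n u v L (suc k)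
  cost-retreat (costᵘ c) = costᵘ (begin
    n + n + v           ≤⟨ c ⟩
    L + L + k + suc u   ≡⟨ solve (List ℕ ∋ L ∷ k ∷ u ∷ []) ⟩
    L + L + suc k + u   ∎)
  cost-retreat (costᵛ c) = costᵛ (begin
    n + n + u           ≤⟨ m≤n+m _ 1 ⟩
    suc (n + n + u)     ≡⟨ +-suc (n + n) u ⟨
    n + n + suc u       ≤⟨ c ⟩
    L + L + k + v       ≤⟨ +-monoˡ-≤ v (+-monoʳ-≤ (L + L) (n≤1+n k)) ⟩
    L + L + suc k + v   ∎)

cost-retreat-shrink : ∀ {n v L k} → Cost n 0 v (suc L) k → Cost n 0 (suc v) L (suc k)
cost-retreat-shrink {n} {v} {L} {k} c = costᵛ (begin
  n + n + 0               ≡⟨ +-identityʳ (n + n) ⟩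
  n + n                   ≤⟨ weaken c ⟩
  suc L + suc L + k + v   ≡⟨ solve (List ℕ ∋ L ∷ k ∷ v ∷ []) ⟩
  L + L + suc k + suc v   ∎)
  where
  open ≤-Reasoning
  weaken : Cost n 0 v (suc L) k → n + n ≤ suc L + suc L + k + v
  weaken (costᵘ c) = begin
    n + n                   ≤⟨ m≤m+n (n + n) v ⟩
    n + n + v               ≤⟨ c ⟩
    suc L + suc L + k + 0   ≤⟨ +-monoʳ-≤ (suc L + suc L + k) z≤n ⟩
    suc L + suc L + k + v   ∎
  weaken (costᵛ c) = ≤-trans (m≤m+n (n + n) 0) c

-- A common window y[u, u + L) = z[v, v + L), no shorter than a walk of length k can force.
record Overlap (k : ℕ) (y z : Word d n) : Set where
  constructor mkOverlap
  field
    u v L : ℕ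
    fitsʸ : u + L ≤ n
    fitsᶻ : v + L ≤ n
    cost  : Cost n u v L k
    agree : ∀ {i} → i < L → at y (u + i) ≡ at z (v + i)

overlap-forward : {y y′ z : Word d n} → Arc y y′ → Overlap k y′ z → Overlap (suc k) y z
overlap-forward arc (mkOverlap u v zero fitsʸ fitsᶻ c _) =
  mkOverlap u v 0 fitsʸ fitsᶻ (cost-mono (n≤1+n _) c) λ ()
overlap-forward {n = n} arc (mkOverlap u v (suc L) fitsʸ fitsᶻ c agree) with suc (u + suc L) ≤? n
... | yes u+L<n = mkOverlap (suc u) v (suc L) u+L<n fitsᶻ (cost-advance c)
  λ i<L → trans (sym (arc-at arc (≤-trans (s≤s (+-monoʳ-< u i<L)) u+L<n))) (agree i<L)
... | no u+L≮n = mkOverlap (suc u) v L (≤-reflexive u+L+1≡n) (≤-trans (+-monoʳ-≤ v (n≤1+n L)) fitsᶻ)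
  (cost-advance-shrink v≤u c)
  λ i<L → trans (sym (arc-at arc (≤-trans (s≤s (+-monoʳ-< u i<L)) (≤-reflexive u+L+1≡n))))
                (agree (≤-trans i<L (n≤1+n L)))
  where
  u+L+1≡n : suc (u + L) ≡ n
  u+L+1≡n = trans (sym (+-suc u L)) (≤-antisym fitsʸ (≮⇒≥ u+L≮n))
  v≤u : v ≤ u
  v≤u = +-cancelʳ-≤ (suc L) v u (≤-trans fitsᶻ (≤-reflexive (trans (sym u+L+1≡n) (sym (+-suc u L)))))

overlap-backward : {y y′ z : Word d n} → Arc y′ y → Overlap k y′ z → Overlap (suc k) y z
overlap-backward arc (mkOverlap (suc u) v L fitsʸ fitsᶻ c agree) =
  mkOverlap u v L (≤-trans (n≤1+n _) fitsʸ) fitsᶻ (cost-retreat c)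
    λ i<L → trans (arc-at arc (≤-trans (+-monoʳ-< (suc u) i<L) fitsʸ)) (agree i<L)
overlap-backward arc (mkOverlap zero v zero fitsʸ fitsᶻ c _) =
  mkOverlap 0 v 0 fitsʸ fitsᶻ (cost-mono (n≤1+n _) c) λ ()
overlap-backward {z = z} arc (mkOverlap zero v (suc L) fitsʸ fitsᶻ c agree) =
  mkOverlap 0 (suc v) L (≤-trans (n≤1+n L) fitsʸ) (≤-trans (≤-reflexive (sym (+-suc v L))) fitsᶻ)
    (cost-retreat-shrink c)
    λ i<L → trans (arc-at arc (≤-trans (s≤s i<L) fitsʸ)) (trans (agree (s≤s i<L)) (cong (at z) (+-suc v _)))

overlap-of-walk : {y z : Word d n} → WalkOfLen k y z → Overlap k y z
overlap-of-walk {n = n} here =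
  mkOverlap 0 0 n ≤-refl ≤-refl (costᵘ (≤-reflexive (sym (+-identityʳ (n + n + 0))))) λ _ → refl
overlap-of-walk (step (inj₁ arc) w) = overlap-forward arc (overlap-of-walk w)
overlap-of-walk (step (inj₂ arc) w) = overlap-backward arc (overlap-of-walk w)

window-bound : ∀ {n a b} L k → a + L ≤ n → n + n + b ≤ L + L + k + a → n + b ≤ L + k
window-bound {n} {a} {b} L k a+L≤n c = +-cancelˡ-≤ n _ _ (begin
  n + (n + b)       ≡⟨ +-assoc n n b ⟨
  n + n + b         ≤⟨ c ⟩
  L + L + k + a     ≡⟨ solve (List ℕ ∋ L ∷ k ∷ a ∷ []) ⟩
  (L + k) + (a + L) ≤⟨ +-monoʳ-≤ (L + k) a+L≤n ⟩
  (L + k) + n       ≡⟨ +-comm (L + k) n ⟩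
  n + (L + k)       ∎)
  where open ≤-Reasoning

overlap-inside : ∀ {n t u v L} → 1 ≤ t → u + L ≤ n → v + L + t ≤ n → Cost n u v L t →
                 u ≡ t × v ≡ 0 × L + t ≡ n
overlap-inside {n} {t} {u} {v} {L} _ fitsʸ v+L+t≤n (costᵘ c) = u≡t , v≡0 , L+t≡n
  where
  open ≤-Reasoning
  n+v≤L+t : n + v ≤ L + t
  n+v≤L+t = window-bound L t fitsʸ c
  v≡0 : v ≡ 0
  v≡0 = m+n≡0⇒m≡0 v (n≤0⇒n≡0 (+-cancelˡ-≤ n _ 0 (begin
    n + (v + v)   ≡⟨ +-assoc n v v ⟨
    n + v + v     ≤⟨ +-monoˡ-≤ v n+v≤L+t ⟩
    L + t + v     ≡⟨ solve (List ℕ ∋ L ∷ t ∷ v ∷ []) ⟩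
    v + L + t     ≤⟨ v+L+t≤n ⟩
    n             ≡⟨ +-identityʳ n ⟨
    n + 0         ∎)))
  L+t≡n : L + t ≡ n
  L+t≡n = ≤-antisym (≤-trans (≤-trans (m≤n+m (L + t) v) (≤-reflexive (sym (+-assoc v L t)))) v+L+t≤n)
                    (≤-trans (m≤m+n n v) n+v≤L+t)
  n≤L+u : n ≤ L + u
  n≤L+u = +-cancelˡ-≤ n _ _ (begin
    n + n             ≤⟨ m≤m+n (n + n) v ⟩
    n + n + v         ≤⟨ c ⟩
    L + L + t + u     ≡⟨ solve (List ℕ ∋ L ∷ t ∷ u ∷ []) ⟩
    (L + t) + (L + u) ≡⟨ cong (_+ (L + u)) L+t≡n ⟩
    n + (L + u)       ∎)
  u≡t : u ≡ t
  u≡t = +-cancelˡ-≡ L u t (begin-equality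
    L + u  ≡⟨ ≤-antisym (≤-trans (≤-reflexive (+-comm L u)) fitsʸ) n≤L+u ⟩
    n      ≡⟨ L+t≡n ⟨
    L + t  ∎)
overlap-inside {n} {t} {u} {v} {L} 1≤t _ v+L+t≤n (costᵛ c) = contradiction (+-cancelˡ-≤ L 1 0 L+1≤L+0) λ ()
  where
  open ≤-Reasoning
  n≤L : n ≤ L
  n≤L = +-cancelˡ-≤ n _ _ (begin
    n + n           ≤⟨ m≤m+n (n + n) u ⟩
    n + n + u       ≤⟨ c ⟩
    L + L + t + v   ≡⟨ solve (List ℕ ∋ L ∷ t ∷ v ∷ []) ⟩
    L + (v + L + t) ≤⟨ +-monoʳ-≤ L v+L+t≤n ⟩
    L + n           ≡⟨ +-comm L n ⟩
    n + L           ∎)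
  L+1≤L+0 : L + 1 ≤ L + 0
  L+1≤L+0 = begin
    L + 1       ≤⟨ +-monoʳ-≤ L 1≤t ⟩
    L + t       ≤⟨ m≤n+m (L + t) v ⟩
    v + (L + t) ≡⟨ +-assoc v L t ⟨
    v + L + t   ≤⟨ v+L+t≤n ⟩
    n           ≤⟨ n≤L ⟩
    L           ≡⟨ +-identityʳ L ⟨
    L + 0       ∎

even⊎odd : ∀ m → ∃ λ j → m ≡ j + j ⊎ m ≡ suc (j + j)
even⊎odd zero    = 0 , inj₁ refl
even⊎odd (suc m) with even⊎odd m
... | j , inj₁ m≡2j   = j , inj₂ (cong suc m≡2j)
... | j , inj₂ m≡2j+1 = suc j , inj₁ (trans (cong suc m≡2j+1) (cong suc (sym (+-suc j j))))

m+m<n+n⇒m<n : ∀ {m n} → m + m < n + n → m < n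
m+m<n+n⇒m<n {m} {n} lt with m <? n
... | yes m<n = m<n
... | no m≮n  = contradiction lt (≤⇒≯ (+-mono-≤ (≮⇒≥ m≮n) (≮⇒≥ m≮n)))

-- Position i of the window sits at z-index n − t + j, on the j-th shifted-in letter of z,
-- and at y-index n − 1 − j or n − 2 − j.
MeetsFresh : (n t u v L : ℕ) → Set
MeetsFresh n t u v L =
  ∃₂ λ i j → v + i + t ≡ n + j × j < t × i < L × (u + i + suc j ≡ n ⊎ u + i + suc (suc j) ≡ n)

-- j is ⌊(t + v − u − 1) / 2⌋.
fresh-position : ∀ {n t u v L} → t + t ≤ n → v ≤ t → u < t + v → n + n ≤ L + L + t + (u + v) →
                 MeetsFresh n t u v L
fresh-position {n} {t} {u} {v} {L} 2t≤n v≤t u<t+v 2n≤ with m≤n⇒∃[o]m+o≡n u<t+v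
... | Q , u+1+Q≡t+v with even⊎odd Q
... | j , Q≡2j+e with m≤n⇒∃[o]m+o≡n (≤-trans (+-monoˡ-≤ t v≤t) (≤-trans 2t≤n (m≤m+n n j)))
... | i , v+t+i≡n+j = i , j , v+i+t≡n+j , j<t , i<L , ends
  where
  open ≤-Reasoning
  2j≤Q : j + j ≤ Q
  2j≤Q = [ (λ e → ≤-reflexive (sym e)) , (λ e → ≤-trans (n≤1+n _) (≤-reflexive (sym e))) ]′ Q≡2j+e
  v+i+t≡n+j : v + i + t ≡ n + j
  v+i+t≡n+j = begin-equality
    v + i + t ≡⟨ solve (List ℕ ∋ v ∷ i ∷ t ∷ []) ⟩
    v + t + i ≡⟨ v+t+i≡n+j ⟩
    n + j     ∎
  j<t : j < t
  j<t = m+m<n+n⇒m<n (begin-strict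
    j + j         ≤⟨ 2j≤Q ⟩
    Q             <⟨ m<n+m Q (s≤s (z≤n {u})) ⟩
    suc u + Q     ≡⟨ u+1+Q≡t+v ⟩
    t + v         ≤⟨ +-monoʳ-≤ t v≤t ⟩
    t + t         ∎)
  i<L : i < L
  i<L = m+m<n+n⇒m<n (+-cancelʳ-≤ (t + t + u + v + v) _ _ (begin
    suc (i + i) + (t + t + u + v + v) ≡⟨ solve (List ℕ ∋ i ∷ t ∷ u ∷ v ∷ []) ⟩
    (v + t + i) + (v + t + i) + suc u ≡⟨ cong (λ w → w + w + suc u) v+t+i≡n+j ⟩
    (n + j) + (n + j) + suc u       ≡⟨ solve (List ℕ ∋ n ∷ j ∷ u ∷ []) ⟩
    n + n + (j + j) + suc u         ≤⟨ +-monoˡ-≤ (suc u) (+-monoʳ-≤ (n + n) 2j≤Q) ⟩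
    n + n + Q + suc u               ≡⟨ solve (List ℕ ∋ n ∷ Q ∷ u ∷ []) ⟩
    n + n + (suc u + Q)             ≡⟨ cong (n + n +_) u+1+Q≡t+v ⟩
    n + n + (t + v)                 ≤⟨ +-monoˡ-≤ (t + v) 2n≤ ⟩
    L + L + t + (u + v) + (t + v)   ≡⟨ solve (List ℕ ∋ L ∷ t ∷ u ∷ v ∷ []) ⟩
    L + L + (t + t + u + v + v)     ∎))
  ends-at : ∀ e → Q ≡ e + (j + j) → u + i + suc j + e ≡ n
  ends-at e Q≡e+2j = +-cancelʳ-≡ j _ _ (begin-equality
    u + i + suc j + e + j   ≡⟨ solve (List ℕ ∋ u ∷ i ∷ j ∷ e ∷ []) ⟩
    suc u + (e + (j + j)) + i ≡⟨ cong (λ w → suc u + w + i) Q≡e+2j ⟨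
    suc u + Q + i           ≡⟨ cong (_+ i) u+1+Q≡t+v ⟩
    t + v + i               ≡⟨ cong (_+ i) (+-comm t v) ⟩
    v + t + i               ≡⟨ v+t+i≡n+j ⟩
    n + j                   ∎)
  ends : u + i + suc j ≡ n ⊎ u + i + suc (suc j) ≡ n
  ends = [ (λ e → inj₁ (trans (sym (+-identityʳ _)) (ends-at 0 e))) ,
           (λ e → inj₂ (trans (+-suc (u + i) (suc j)) (trans (+-comm 1 (u + i + suc j)) (ends-at 1 e)))) ]′ Q≡2j+e

overlap-meets-fresh : ∀ {n t u v L} → t + t ≤ n → u + L ≤ n → v + L ≤ n → Cost n u v L t →
                      n < v + L + t → MeetsFresh n t u v L
overlap-meets-fresh {n} {t} {u} {v} {L} 2t≤n fitsʸ fitsᶻ c n<v+L+t =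
  fresh-position 2t≤n v≤t u<t+v (cost-total c)
  where
  open ≤-Reasoning
  n≤L+t : Cost n u v L t → n ≤ L + t
  n≤L+t (costᵘ c) = ≤-trans (m≤m+n n v) (window-bound L t fitsʸ c)
  n≤L+t (costᵛ c) = ≤-trans (m≤m+n n u) (window-bound L t fitsᶻ c)
  v≤t : v ≤ t
  v≤t = +-cancelˡ-≤ L _ _ (begin
    L + v ≡⟨ +-comm L v ⟩
    v + L ≤⟨ fitsᶻ ⟩
    n     ≤⟨ n≤L+t c ⟩
    L + t ∎)
  cost-total : Cost n u v L t → n + n ≤ L + L + t + (u + v)
  cost-total (costᵘ c) = begin
    n + n               ≤⟨ m≤m+n (n + n) v ⟩
    n + n + v           ≤⟨ c ⟩
    L + L + t + u       ≤⟨ +-monoʳ-≤ (L + L + t) (m≤m+n u v) ⟩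
    L + L + t + (u + v) ∎
  cost-total (costᵛ c) = begin
    n + n               ≤⟨ m≤m+n (n + n) u ⟩
    n + n + u           ≤⟨ c ⟩
    L + L + t + v       ≤⟨ +-monoʳ-≤ (L + L + t) (m≤n+m v u) ⟩
    L + L + t + (u + v) ∎
  u<t+v : u < t + v
  u<t+v = +-cancelʳ-< L u (t + v) (begin-strict
    u + L       ≤⟨ fitsʸ ⟩
    n           <⟨ n<v+L+t ⟩
    v + L + t   ≡⟨ solve (List ℕ ∋ v ∷ L ∷ t ∷ []) ⟩
    t + v + L   ∎)

private
  _≟_ : (a b : Maybe (Fin d)) → Dec (a ≡ b)
  _≟_ = ≡-dec _≟ᶠ_

fresh-symbol : 3 ≤ d → (a b : Maybe (Fin d)) → ∃ λ c → just c ≢ a × just c ≢ b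
fresh-symbol (s≤s (s≤s (s≤s _))) a b with just 0F ≟ a | just 0F ≟ b
... | no 0≢a | no 0≢b = 0F , 0≢a , 0≢b
... | yes refl | _ with just 1F ≟ b
...   | no 1≢b   = 1F , (λ ()) , 1≢b
...   | yes refl = 2F , (λ ()) , (λ ())
fresh-symbol (s≤s (s≤s (s≤s _))) a b | no _ | yes refl with just 1F ≟ a
...   | no 1≢a   = 1F , 1≢a , (λ ())
...   | yes refl = 2F , (λ ()) , (λ ())

Separated : ℕ → Word d n → Word d n → Set
Separated {d} {n} t x y = ∃ λ (z : Word d n) → InBall t x z × ¬ InBall t y z

DifferFrom : ℕ → Word d n → Word d n → Set
DifferFrom {n = n} t x y = ∃ λ j → t ≤ j × j < n × at x j ≢ at y j

separating-vertex : 3 ≤ d → 1 ≤ t → t + t ≤ n → {x y : Word d n} → DifferFrom t x y → Separated t x y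
separating-vertex {d} {t} {n} 3≤d 1≤t 2t≤n {x} {y} (_ , t≤j , j<n , xⱼ≢yⱼ) =
  z , (t , ≤-refl , walk-shifts t fresh x) , z∉Bₜy
  where
  avoiding : (j : ℕ) → ∃ λ c → just c ≢ at y (n ∸ suc j) × just c ≢ at y (n ∸ suc (suc j))
  avoiding j = fresh-symbol 3≤d (at y (n ∸ suc j)) (at y (n ∸ suc (suc j)))
  fresh : ℕ → Fin d
  fresh j = proj₁ (avoiding j)
  z : Word d n
  z = shifts t fresh x
  z∉Bₜy : ¬ InBall t y z
  z∉Bₜy (k , k≤t , w) with overlap-of-walk w
  ... | mkOverlap u v L fitsʸ fitsᶻ c agree with v + L + t ≤? n
  ...   | yes v+L+t≤n with overlap-inside 1≤t fitsʸ v+L+t≤n (cost-mono k≤t c) | m≤n⇒∃[o]m+o≡n t≤j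
  ...     | refl , refl , L+t≡n | i , refl = xⱼ≢yⱼ (begin
    at x (t + i)  ≡⟨ at-shifts-kept t fresh x j<n ⟨
    at z i        ≡⟨ agree i<L ⟨
    at y (t + i)  ∎)
    where
    open ≡-Reasoning
    i<L : i < L
    i<L = +-cancelˡ-< t i L (≤-trans j<n (≤-reflexive (trans (sym L+t≡n) (+-comm L t))))
  z∉Bₜy (k , k≤t , w) | mkOverlap u v L fitsʸ fitsᶻ c agree | no v+L+t≰n
    with overlap-meets-fresh 2t≤n fitsʸ fitsᶻ (cost-mono k≤t c) (≰⇒> v+L+t≰n)
  ... | i , j , v+i+t≡n+j , j<t , i<L , ends =
    [ (λ e → proj₁ (proj₂ (avoiding j)) (lands-at e)) , (λ e → proj₂ (proj₂ (avoiding j)) (lands-at e)) ]′ ends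
    where
    lands-at : ∀ {m} → u + i + m ≡ n → just (fresh j) ≡ at y (n ∸ m)
    lands-at {m} e = begin
      just (fresh j)       ≡⟨ at-shifts-new t fresh x v+i+t≡n+j j<t ⟨
      at z (v + i)         ≡⟨ agree i<L ⟨
      at y (u + i)         ≡⟨ cong (at y) (m+n∸n≡m (u + i) m) ⟨
      at y (u + i + m ∸ m) ≡⟨ cong (λ p → at y (p ∸ m)) e ⟩
      at y (n ∸ m)         ∎
      where open ≡-Reasoning

distinct⇒differFrom0 : {x y : Word d n} → x ≢ y → DifferFrom 0 x y
distinct⇒differFrom0 {x = []}    {[]}    x≢y = contradiction refl x≢y
distinct⇒differFrom0 {x = a ∷ x} {b ∷ y} x≢y with a ≟ᶠ b
... | no a≢b = 0 , z≤n , s≤s z≤n , λ e → a≢b (just-injective e)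
... | yes refl with distinct⇒differFrom0 (λ e → x≢y (cong (a ∷_) e))
...   | j , _ , j<n , xⱼ≢yⱼ = suc j , z≤n , s≤s j<n , xⱼ≢yⱼ

differFrom-or-reverse : t + t ≤ n → {x y : Word d n} → DifferFrom 0 x y →
                        DifferFrom t x y ⊎ DifferFrom t (reverse x) (reverse y)
differFrom-or-reverse {t} {n} 2t≤n {x} {y} (j , _ , j<n , xⱼ≢yⱼ) with t ≤? j | m≤n⇒∃[o]m+o≡n j<n
... | yes t≤j | _ = inj₁ (j , t≤j , j<n , xⱼ≢yⱼ)
... | no t≰j | i , j+1+i≡n = inj₂ (i , t≤i , i<n ,
  λ e → xⱼ≢yⱼ (trans (sym (at-reverse x i+j+1≡n)) (trans e (at-reverse y i+j+1≡n))))
  where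
  open ≤-Reasoning
  i+j+1≡n : suc (i + j) ≡ n
  i+j+1≡n = trans (cong suc (+-comm i j)) j+1+i≡n
  i<n : i < n
  i<n = ≤-trans (s≤s (m≤m+n i j)) (≤-reflexive i+j+1≡n)
  t≤i : t ≤ i
  t≤i = +-cancelʳ-≤ (suc j) t i (begin
    t + suc j ≤⟨ +-monoʳ-≤ t (≰⇒> t≰j) ⟩
    t + t     ≤⟨ 2t≤n ⟩
    n         ≡⟨ j+1+i≡n ⟨
    suc j + i ≡⟨ +-comm (suc j) i ⟩
    i + suc j ∎)

separated-reverse : {x y : Word d n} → Separated t (reverse x) (reverse y) → Separated t x y
separated-reverse {t = t} {x} {y} (z , xz , ¬yz) =
  reverse z , subst (λ w → InBall t w (reverse z)) (reverse-involutive x) (inBall-reverse xz) ,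
  λ yz → ¬yz (subst (InBall t (reverse y)) (reverse-involutive z) (inBall-reverse yz))

distinct⇒separated : 3 ≤ d → 1 ≤ t → t + t ≤ n → {x y : Word d n} → x ≢ y → Separated t x y
distinct⇒separated 3≤d 1≤t 2t≤n {x} {y} x≢y with differFrom-or-reverse 2t≤n {x} {y} (distinct⇒differFrom0 x≢y)
... | inj₁ δ = separating-vertex 3≤d 1≤t 2t≤n δ
... | inj₂ δ = separated-reverse (separating-vertex 3≤d 1≤t 2t≤n δ)

mainTheorem1 : (d t n : ℕ) → 3 ≤ d → 1 ≤ t → 2 * t ≤ n → Identifiable d n t
mainTheorem1 d t n 3≤d 1≤t 2t≤n = (λ _ → true) , covers , separates
  where
  t+t≤n : t + t ≤ n
  t+t≤n = subst (_≤ n) (cong (t +_) (+-identityʳ t)) 2t≤n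
  covers : ∀ (x : Word d n) → ∃ λ z → InBall t x z × z ∈S (λ _ → true)
  covers x = x , (0 , z≤n , here) , refl
  separates : ∀ (x y : Word d n) → x ≢ y →
              ¬ (∀ z → z ∈S (λ _ → true) → (InBall t x z ⇔ InBall t y z))
  separates x y x≢y same-balls with distinct⇒separated 3≤d 1≤t t+t≤n x≢y
  ... | z , xz , ¬yz = ¬yz (Equivalence.to (same-balls z refl) xz)
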